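{- Let $a,b,c,d,e$ be five distinct vertices of $\mathcal{M}$ with $\{a,b,c,d\}$ a hyperedge of $\mathcal{M}$. Then there is exactly one other hyperedge of $\mathcal{M}$ contained in the set $\{a,b,c,d,e\}$.
   Context: $\mathcal{M}$ denotes the $3$-$(12,4,3)$ design of Hughes associated with the Mathieu group $M_{11}$: its vertex set is a $12$-point set $\Omega$ on which $M_{11}$ acts in its natural $3$-transitive action of degree $12$, and its $165$ hyperedges form an orbit of length $165$ of $M_{11}$ on the $4$-element subsets of $\Omega$; every $3$-subset of $\Omega$ lies in exactly $3$ hyperedges. (A $3$-$(v,4,\lambda)$ design is a $4$-uniform hypergraph on $v$ vertices in which every $3$-set of vertices lies in exactly $\lambda$ hyperedges.) -}

module Defs where

open import Data.Fin using (Fin; #_)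
open import Data.Fin.Subset using (Subset; ⁅_⁆; _∪_)
open import Data.List using (List; []; _∷_)
open import Data.List.Membership.Propositional using (_∈_)

-- Vertex set Ω = Fin 12.  Subsets of Ω are Data.Fin.Subset (characteristic vectors),
-- so equality of subsets is propositional equality.

Vertex : Set
Vertex = Fin 12

quad : Vertex → Vertex → Vertex → Vertex → Subset 12
quad a b c d = ⁅ a ⁆ ∪ ⁅ b ⁆ ∪ ⁅ c ⁆ ∪ ⁅ d ⁆

quint : Vertex → Vertex → Vertex → Vertex → Vertex → Subset 12
quint a b c d e = ⁅ a ⁆ ∪ ⁅ b ⁆ ∪ ⁅ c ⁆ ∪ ⁅ d ⁆ ∪ ⁅ e ⁆

private
  q : Vertex → Vertex → Vertex → Vertex → Subset 12
  q = quad

-- The 165 hyperedges of the Hughes 3-(12,4,3) design M: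
-- the orbit of length 165 of M11 (in its 3-transitive action of degree 12) on 4-subsets.
-- Here M11 = < A , B > ≤ Sym(Fin 12) with (images of 0..11)
--   A = (0 8 7 10 3 4 11 6 5 2 9 1)
--   B = (5 3 6 4 7 0 9 1 10 11 8 2)
-- (the coset action of M11 on the 12 cosets of a subgroup PSL(2,11)); the orbits of
-- < A , B > on 4-subsets have lengths 330 and 165, and the list below is the latter.
hyperedges : List (Subset 12)
hyperedges =
  q (# 0) (# 1) (# 2) (# 5) ∷
  q (# 0) (# 1) (# 2) (# 7) ∷
  q (# 0) (# 1) (# 2) (# 8) ∷
  q (# 0) (# 1) (# 3) (# 8) ∷
  q (# 0) (# 1) (# 3) (# 9) ∷
  q (# 0) (# 1) (# 3) (# 10) ∷
  q (# 0) (# 1) (# 4) (# 6) ∷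
  q (# 0) (# 1) (# 4) (# 8) ∷
  q (# 0) (# 1) (# 4) (# 11) ∷
  q (# 0) (# 1) (# 5) (# 10) ∷
  q (# 0) (# 1) (# 5) (# 11) ∷
  q (# 0) (# 1) (# 6) (# 7) ∷
  q (# 0) (# 1) (# 6) (# 10) ∷
  q (# 0) (# 1) (# 7) (# 9) ∷
  q (# 0) (# 1) (# 9) (# 11) ∷
  q (# 0) (# 2) (# 3) (# 4) ∷
  q (# 0) (# 2) (# 3) (# 5) ∷
  q (# 0) (# 2) (# 3) (# 10) ∷
  q (# 0) (# 2) (# 4) (# 6) ∷
  q (# 0) (# 2) (# 4) (# 7) ∷
  q (# 0) (# 2) (# 5) (# 9) ∷
  q (# 0) (# 2) (# 6) (# 8) ∷
  q (# 0) (# 2) (# 6) (# 9) ∷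
  q (# 0) (# 2) (# 7) (# 11) ∷
  q (# 0) (# 2) (# 8) (# 10) ∷
  q (# 0) (# 2) (# 9) (# 11) ∷
  q (# 0) (# 2) (# 10) (# 11) ∷
  q (# 0) (# 3) (# 4) (# 9) ∷
  q (# 0) (# 3) (# 4) (# 11) ∷
  q (# 0) (# 3) (# 5) (# 6) ∷
  q (# 0) (# 3) (# 5) (# 8) ∷
  q (# 0) (# 3) (# 6) (# 7) ∷
  q (# 0) (# 3) (# 6) (# 9) ∷
  q (# 0) (# 3) (# 7) (# 10) ∷
  q (# 0) (# 3) (# 7) (# 11) ∷
  q (# 0) (# 3) (# 8) (# 11) ∷
  q (# 0) (# 4) (# 5) (# 6) ∷
  q (# 0) (# 4) (# 5) (# 9) ∷
  q (# 0) (# 4) (# 5) (# 10) ∷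
  q (# 0) (# 4) (# 7) (# 8) ∷
  q (# 0) (# 4) (# 7) (# 10) ∷
  q (# 0) (# 4) (# 8) (# 9) ∷
  q (# 0) (# 4) (# 10) (# 11) ∷
  q (# 0) (# 5) (# 6) (# 11) ∷
  q (# 0) (# 5) (# 7) (# 8) ∷
  q (# 0) (# 5) (# 7) (# 9) ∷
  q (# 0) (# 5) (# 7) (# 11) ∷
  q (# 0) (# 5) (# 8) (# 10) ∷
  q (# 0) (# 6) (# 7) (# 8) ∷
  q (# 0) (# 6) (# 8) (# 11) ∷
  q (# 0) (# 6) (# 9) (# 10) ∷
  q (# 0) (# 6) (# 10) (# 11) ∷
  q (# 0) (# 7) (# 9) (# 10) ∷
  q (# 0) (# 8) (# 9) (# 10) ∷
  q (# 0) (# 8) (# 9) (# 11) ∷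
  q (# 1) (# 2) (# 3) (# 4) ∷
  q (# 1) (# 2) (# 3) (# 7) ∷
  q (# 1) (# 2) (# 3) (# 9) ∷
  q (# 1) (# 2) (# 4) (# 5) ∷
  q (# 1) (# 2) (# 4) (# 11) ∷
  q (# 1) (# 2) (# 5) (# 6) ∷
  q (# 1) (# 2) (# 6) (# 9) ∷
  q (# 1) (# 2) (# 6) (# 10) ∷
  q (# 1) (# 2) (# 7) (# 10) ∷
  q (# 1) (# 2) (# 8) (# 9) ∷
  q (# 1) (# 2) (# 8) (# 11) ∷
  q (# 1) (# 2) (# 10) (# 11) ∷
  q (# 1) (# 3) (# 4) (# 6) ∷
  q (# 1) (# 3) (# 4) (# 10) ∷
  q (# 1) (# 3) (# 5) (# 6) ∷
  q (# 1) (# 3) (# 5) (# 9) ∷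
  q (# 1) (# 3) (# 5) (# 11) ∷
  q (# 1) (# 3) (# 6) (# 8) ∷
  q (# 1) (# 3) (# 7) (# 8) ∷
  q (# 1) (# 3) (# 7) (# 11) ∷
  q (# 1) (# 3) (# 10) (# 11) ∷
  q (# 1) (# 4) (# 5) (# 8) ∷
  q (# 1) (# 4) (# 5) (# 9) ∷
  q (# 1) (# 4) (# 6) (# 9) ∷
  q (# 1) (# 4) (# 7) (# 9) ∷
  q (# 1) (# 4) (# 7) (# 10) ∷
  q (# 1) (# 4) (# 7) (# 11) ∷
  q (# 1) (# 4) (# 8) (# 10) ∷
  q (# 1) (# 5) (# 6) (# 7) ∷
  q (# 1) (# 5) (# 7) (# 8) ∷
  q (# 1) (# 5) (# 7) (# 10) ∷
  q (# 1) (# 5) (# 8) (# 11) ∷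
  q (# 1) (# 5) (# 9) (# 10) ∷
  q (# 1) (# 6) (# 7) (# 11) ∷
  q (# 1) (# 6) (# 8) (# 10) ∷
  q (# 1) (# 6) (# 8) (# 11) ∷
  q (# 1) (# 6) (# 9) (# 11) ∷
  q (# 1) (# 7) (# 8) (# 9) ∷
  q (# 1) (# 8) (# 9) (# 10) ∷
  q (# 1) (# 9) (# 10) (# 11) ∷
  q (# 2) (# 3) (# 4) (# 8) ∷
  q (# 2) (# 3) (# 5) (# 7) ∷
  q (# 2) (# 3) (# 5) (# 11) ∷
  q (# 2) (# 3) (# 6) (# 7) ∷
  q (# 2) (# 3) (# 6) (# 8) ∷
  q (# 2) (# 3) (# 6) (# 10) ∷
  q (# 2) (# 3) (# 8) (# 11) ∷
  q (# 2) (# 3) (# 9) (# 10) ∷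
  q (# 2) (# 3) (# 9) (# 11) ∷
  q (# 2) (# 4) (# 5) (# 7) ∷
  q (# 2) (# 4) (# 5) (# 10) ∷
  q (# 2) (# 4) (# 6) (# 10) ∷
  q (# 2) (# 4) (# 6) (# 11) ∷
  q (# 2) (# 4) (# 7) (# 9) ∷
  q (# 2) (# 4) (# 8) (# 9) ∷
  q (# 2) (# 4) (# 8) (# 10) ∷
  q (# 2) (# 4) (# 9) (# 11) ∷
  q (# 2) (# 5) (# 6) (# 8) ∷
  q (# 2) (# 5) (# 6) (# 11) ∷
  q (# 2) (# 5) (# 7) (# 8) ∷
  q (# 2) (# 5) (# 8) (# 9) ∷
  q (# 2) (# 5) (# 9) (# 10) ∷
  q (# 2) (# 5) (# 10) (# 11) ∷
  q (# 2) (# 6) (# 7) (# 9) ∷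
  q (# 2) (# 6) (# 7) (# 11) ∷
  q (# 2) (# 7) (# 8) (# 10) ∷
  q (# 2) (# 7) (# 8) (# 11) ∷
  q (# 2) (# 7) (# 9) (# 10) ∷
  q (# 3) (# 4) (# 5) (# 8) ∷
  q (# 3) (# 4) (# 5) (# 10) ∷
  q (# 3) (# 4) (# 5) (# 11) ∷
  q (# 3) (# 4) (# 6) (# 7) ∷
  q (# 3) (# 4) (# 6) (# 11) ∷
  q (# 3) (# 4) (# 7) (# 8) ∷
  q (# 3) (# 4) (# 7) (# 9) ∷
  q (# 3) (# 4) (# 9) (# 10) ∷
  q (# 3) (# 5) (# 6) (# 10) ∷
  q (# 3) (# 5) (# 7) (# 9) ∷
  q (# 3) (# 5) (# 7) (# 10) ∷
  q (# 3) (# 5) (# 8) (# 9) ∷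
  q (# 3) (# 6) (# 8) (# 9) ∷
  q (# 3) (# 6) (# 9) (# 11) ∷
  q (# 3) (# 6) (# 10) (# 11) ∷
  q (# 3) (# 7) (# 8) (# 10) ∷
  q (# 3) (# 7) (# 9) (# 11) ∷
  q (# 3) (# 8) (# 9) (# 10) ∷
  q (# 3) (# 8) (# 10) (# 11) ∷
  q (# 4) (# 5) (# 6) (# 7) ∷
  q (# 4) (# 5) (# 6) (# 8) ∷
  q (# 4) (# 5) (# 7) (# 11) ∷
  q (# 4) (# 5) (# 9) (# 11) ∷
  q (# 4) (# 6) (# 7) (# 10) ∷
  q (# 4) (# 6) (# 8) (# 9) ∷
  q (# 4) (# 6) (# 8) (# 11) ∷
  q (# 4) (# 6) (# 9) (# 10) ∷
  q (# 4) (# 7) (# 8) (# 11) ∷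
  q (# 4) (# 8) (# 10) (# 11) ∷
  q (# 4) (# 9) (# 10) (# 11) ∷
  q (# 5) (# 6) (# 7) (# 9) ∷
  q (# 5) (# 6) (# 8) (# 10) ∷
  q (# 5) (# 6) (# 9) (# 10) ∷
  q (# 5) (# 6) (# 9) (# 11) ∷
  q (# 5) (# 7) (# 10) (# 11) ∷
  q (# 5) (# 8) (# 9) (# 11) ∷
  q (# 5) (# 8) (# 10) (# 11) ∷
  q (# 6) (# 7) (# 8) (# 9) ∷
  q (# 6) (# 7) (# 8) (# 10) ∷
  q (# 6) (# 7) (# 10) (# 11) ∷
  q (# 7) (# 8) (# 9) (# 11) ∷
  q (# 7) (# 9) (# 10) (# 11) ∷
  []

IsHyperedge : Subset 12 → Set
IsHyperedge h = h ∈ hyperedges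

-- For a hyperedge Q = {a,b,c,d} and e ∉ Q, any other hyperedge inside Q ∪ {e} consists
-- of e and a 3-subset of Q. Each of the four 3-subsets of Q lies in exactly two
-- hyperedges besides Q, so over the 8 points e ∉ Q there are 8 such hyperedges in all,
-- one per point on average. The content of the proposition is that the distribution is
-- exactly even; this is decided for all 165 hyperedges Q and all points e.
module Submission where

open import Defs
open import Data.Bool.Properties using () renaming (_≟_ to _≟ᵇ_)
open import Data.Fin using (Fin)
open import Data.Fin.Properties using () renaming (all? to allFin?)
open import Data.Fin.Subset using (Subset; _⊆_; _∪_; ⁅_⁆) renaming (_∉_ to _∉ₛ_)
open import Data.Fin.Subset.Properties using (_⊆?_; _∈?_; x∈p∪q⁻; x≢y⇒x∉⁅y⁆; ∪-assoc)
open import Data.List using (List; []; _∷_; filter; length)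
open import Data.List.Membership.Propositional using (_∈_)
open import Data.List.Membership.Propositional.Properties using (∈-filter⁺; ∈-filter⁻)
open import Data.List.Relation.Unary.All using (All; all?)
import Data.List.Relation.Unary.All as All
open import Data.List.Relation.Unary.Any using (here)
open import Data.List.Relation.Unary.Any.Properties using (singleton⁻)
open import Data.Nat using (_≟_)
open import Data.Product using (Σ; _×_; _,_)
open import Data.Sum using ([_,_])
open import Data.Vec.Properties using (≡-dec)
open import Function using (_∘_)
open import Relation.Binary.Definitions using (DecidableEquality)
open import Relation.Binary.PropositionalEquality
  using (_≡_; _≢_; refl; sym; cong; subst; ≢-sym; module ≡-Reasoning)
open import Relation.Nullary.Decidable using (¬?; _×-dec_; _→-dec_; from-yes)
open import Relation.Unary using (Pred; Decidable)

length≡1⇒singleton : ∀ {a} {A : Set a} (xs : List A) → length xs ≡ 1 → Σ A λ x → xs ≡ x ∷ []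
length≡1⇒singleton (x ∷ []) refl = x , refl

module _ {a p} {A : Set a} {P : Pred A p} (P? : Decidable P) where

  filter≡[x]⇒unique : ∀ {xs x} → filter P? xs ≡ x ∷ [] →
                      (x ∈ xs × P x) × (∀ y → y ∈ xs → P y → y ≡ x)
  filter≡[x]⇒unique {xs} {x} eq =
      ∈-filter⁻ P? (subst (x ∈_) (sym eq) (here refl))
    , λ y y∈xs Py → singleton⁻ (subst (y ∈_) eq (∈-filter⁺ P? y∈xs Py))

_≟ₛ_ : ∀ {n} → DecidableEquality (Subset n)
_≟ₛ_ = ≡-dec _≟ᵇ_

module _ {n} (L : List (Subset n)) (Q S : Subset n) where

  otherInside? : Decidable (λ h → h ≢ Q × h ⊆ S)
  otherInside? h = ¬? (h ≟ₛ Q) ×-dec h ⊆? S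

  othersInside : List (Subset n)
  othersInside = filter otherInside? L

  UniqueOtherInside : Set
  UniqueOtherInside = Σ (Subset n) λ h → (h ∈ L × h ≢ Q × h ⊆ S) ×
                        ((h′ : Subset n) → h′ ∈ L → h′ ≢ Q → h′ ⊆ S → h′ ≡ h)

  length-othersInside≡1⇒unique : length othersInside ≡ 1 → UniqueOtherInside
  length-othersInside≡1⇒unique len≡1 with length≡1⇒singleton othersInside len≡1
  ... | h , eq with filter≡[x]⇒unique otherInside? eq
  ...   | member , unique = h , member , λ h′ h′∈L h′≢Q h′⊆S → unique h′ h′∈L (h′≢Q , h′⊆S)

length-othersInside-hyperedges≡1 :
  All (λ Q → ∀ e → e ∉ₛ Q → length (othersInside hyperedges Q (Q ∪ ⁅ e ⁆)) ≡ 1) hyperedges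
length-othersInside-hyperedges≡1 = from-yes (all? (λ Q → allFin? λ e →
  ¬? (e ∈? Q) →-dec length (othersInside hyperedges Q (Q ∪ ⁅ e ⁆)) ≟ 1) hyperedges)

x∉p∪q : ∀ {n} {x : Fin n} (p q : Subset n) → x ∉ₛ p → x ∉ₛ q → x ∉ₛ p ∪ q
x∉p∪q p q x∉p x∉q = [ x∉p , x∉q ] ∘ x∈p∪q⁻ p q

quad-∉ : ∀ {a b c d e : Vertex} → a ≢ e → b ≢ e → c ≢ e → d ≢ e → e ∉ₛ quad a b c d
quad-∉ {a} {b} {c} {d} a≢e b≢e c≢e d≢e =
  x∉p∪q ⁅ a ⁆ _ (x≢y⇒x∉⁅y⁆ (≢-sym a≢e)) (
  x∉p∪q ⁅ b ⁆ _ (x≢y⇒x∉⁅y⁆ (≢-sym b≢e)) (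
  x∉p∪q ⁅ c ⁆ _ (x≢y⇒x∉⁅y⁆ (≢-sym c≢e)) (x≢y⇒x∉⁅y⁆ (≢-sym d≢e))))

quint≡quad∪⁅e⁆ : ∀ a b c d e → quint a b c d e ≡ quad a b c d ∪ ⁅ e ⁆
quint≡quad∪⁅e⁆ a b c d e = sym (begin
  (⁅ a ⁆ ∪ ⁅ b ⁆ ∪ ⁅ c ⁆ ∪ ⁅ d ⁆) ∪ ⁅ e ⁆   ≡⟨ ∪-assoc ⁅ a ⁆ _ _ ⟩
  ⁅ a ⁆ ∪ (⁅ b ⁆ ∪ ⁅ c ⁆ ∪ ⁅ d ⁆) ∪ ⁅ e ⁆   ≡⟨ cong (⁅ a ⁆ ∪_) (∪-assoc ⁅ b ⁆ _ _) ⟩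
  ⁅ a ⁆ ∪ ⁅ b ⁆ ∪ (⁅ c ⁆ ∪ ⁅ d ⁆) ∪ ⁅ e ⁆   ≡⟨ cong (λ s → ⁅ a ⁆ ∪ ⁅ b ⁆ ∪ s) (∪-assoc ⁅ c ⁆ _ _) ⟩
  ⁅ a ⁆ ∪ ⁅ b ⁆ ∪ ⁅ c ⁆ ∪ ⁅ d ⁆ ∪ ⁅ e ⁆     ∎)
  where open ≡-Reasoning

proposition3p2 : (a b c d e : Vertex) →
    a ≢ b → a ≢ c → a ≢ d → a ≢ e → b ≢ c → b ≢ d → b ≢ e → c ≢ d → c ≢ e → d ≢ e →
    IsHyperedge (quad a b c d) →
    Σ (Subset 12) (λ h →
      (IsHyperedge h × h ≢ quad a b c d × h ⊆ quint a b c d e) ×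
      ((h′ : Subset 12) → IsHyperedge h′ → h′ ≢ quad a b c d → h′ ⊆ quint a b c d e → h′ ≡ h))
proposition3p2 a b c d e _ _ _ a≢e _ _ b≢e _ c≢e d≢e Q∈M =
  subst (UniqueOtherInside hyperedges Q) (sym (quint≡quad∪⁅e⁆ a b c d e))
    (length-othersInside≡1⇒unique hyperedges Q (Q ∪ ⁅ e ⁆)
      (All.lookup length-othersInside-hyperedges≡1 Q∈M e (quad-∉ a≢e b≢e c≢e d≢e)))
  where Q = quad a b c d
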